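{- For every positive integer $L$ there is a family of oriented simple graphs of increasing size, each of which is a local optimum of \textsc{Path-Local-Search} with parameter $L$ (i.e., there is no directed path $u_0\to u_1\to\cdots\to u_l$ with $l\le L$ and $\mathrm{disc}(u_l)>\mathrm{disc}(u_0)+2$), such that the member with discrepancy $\max_v|\mathrm{disc}(v)|=k$ has $O(k^3L^2)$ vertices.
   Context: For an orientation, $\mathrm{disc}(v)=|\delta_{\mathrm{in}}(v)|-|\delta_{\mathrm{out}}(v)|$. \textsc{Path-Local-Search} with parameter $L$ repeatedly finds a directed path $(u_0,\dots,u_l)$ with $l\le L$ and $\mathrm{disc}(u_l)>\mathrm{disc}(u_0)+2$ and reverses all edges of the path. -}

module Defs where

open import Data.Nat using (ℕ; zero; suc; _+_; _≤_; _<_)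
open import Data.Bool using (Bool; true; false; T; if_then_else_)
open import Data.Fin using (Fin; inject₁; fromℕ) renaming (suc to fsuc)
open import Data.List using (List; map)
open import Data.Nat.ListAction using (sum)
open import Data.List.Base using (allFin)
open import Data.Integer as ℤ using (ℤ; +_; _-_)
open import Data.Product using (Σ; ∃; _×_; _,_)
open import Relation.Nullary using (¬_)
open import Function.Definitions using (Injective)
open import Relation.Binary.PropositionalEquality using (_≡_)

-- An oriented simple graph on vertex set Fin n:
-- arc u v = true means the edge {u,v} is present and oriented u → v.
record OrientedGraph (n : ℕ) : Set where
  field
    arc        : Fin n → Fin n → Bool
    loopless   : ∀ v → arc v v ≡ false
    oriented   : ∀ u v → T (arc u v) → arc v u ≡ false
open OrientedGraph public

indicator : Bool → ℕ
indicator true  = 1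
indicator false = 0

indeg : ∀ {n} → OrientedGraph n → Fin n → ℕ
indeg {n} G v = sum (map (λ u → indicator (arc G u v)) (allFin n))

outdeg : ∀ {n} → OrientedGraph n → Fin n → ℕ
outdeg {n} G v = sum (map (λ w → indicator (arc G v w)) (allFin n))

disc : ∀ {n} → OrientedGraph n → Fin n → ℤ
disc G v = (+ indeg G v) - (+ outdeg G v)

HasDiscrepancy : ∀ {n} → OrientedGraph n → ℕ → Set
HasDiscrepancy {n} G k =
  (∀ v → ℤ.∣ disc G v ∣ ≤ k) × (∃ λ v → ℤ.∣ disc G v ∣ ≡ k)

record DirectedPath {n : ℕ} (G : OrientedGraph n) (l : ℕ) : Set where
  field
    vertex   : Fin (suc l) → Fin n
    distinct : Injective _≡_ _≡_ vertex
    edges    : ∀ (i : Fin l) → T (arc G (vertex (inject₁ i)) (vertex (fsuc i)))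
  start : Fin n
  start = vertex Data.Fin.zero
  end : Fin n
  end = vertex (fromℕ l)
open DirectedPath public

PathLocalOptimum : ∀ {n} → ℕ → OrientedGraph n → Set
PathLocalOptimum L G =
  ∀ l → l ≤ L → (p : DirectedPath G l) →
    ¬ (disc G (start p) ℤ.+ + 2 ℤ.< disc G (end p))

{-# OPTIONS --safe #-}
module Submission where

-- Take (k + 1) L layers of s vertices each, with a complete bipartite graph between
-- consecutive layers and no other edges.  These bipartite graphs can be oriented so that
-- every vertex of layer t has discrepancy 2 (⌊t / L⌋ − m), where k = 2 m: a staircase that
-- rises by one only every L layers.  An arc climbs at most one layer, so a directed path of
-- length at most L crosses at most one step of the staircase and its discrepancy grows by at
-- most 2.  The orientation needs s = 2 (k + 1) L m, hence k (k + 1)² L² ≤ 4 k³ L² vertices.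

open import Data.Bool using (Bool; true; false; not; if_then_else_; T)
open import Data.Bool.Properties using (T-≡; T-not-≡)
open import Data.Fin as Fin using (Fin; toℕ)
import Data.Fin.Properties as FinP
import Data.Integer as ℤ
import Data.Integer.Properties as ℤP
open import Data.List using (map)
open import Data.List.Base using (allFin; tabulate)
open import Data.List.Properties using (map-tabulate)
open import Data.Nat hiding (∣_-_∣)
open import Data.Nat.DivMod
open import Data.Nat.Divisibility using (∣-refl)
open import Data.Nat.ListAction using (sum)
open import Data.Nat.Properties
import Data.Nat.Tactic.RingSolver as ℕ-Solver
open import Data.Product using (Σ; ∃; _×_; _,_)
open import Data.Sum using (inj₁; inj₂)
open import Function using (_∘_; id)
open import Function.Bundles using (Equivalence)
open import Relation.Binary.PropositionalEquality
open import Defs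
open import Algebra.Properties.CommutativeSemigroup +-commutativeSemigroup using (interchange)

∑< : ℕ → (ℕ → ℕ) → ℕ
∑< zero    f = 0
∑< (suc n) f = f 0 + ∑< n (f ∘ suc)

syntax ∑< n (λ j → e) = ∑[ j < n ] e

∑-cong : ∀ n {f g : ℕ → ℕ} → (∀ j → j < n → f j ≡ g j) → ∑< n f ≡ ∑< n g
∑-cong zero    f≗g = refl
∑-cong (suc n) f≗g = cong₂ _+_ (f≗g 0 z<s) (∑-cong n (λ j j<n → f≗g (suc j) (s<s j<n)))

∑-const : ∀ n c → ∑[ j < n ] c ≡ n * c
∑-const zero    c = refl
∑-const (suc n) c = cong (c +_) (∑-const n c)

∑-zero : ∀ n → ∑[ j < n ] 0 ≡ 0
∑-zero n = trans (∑-const n 0) (*-zeroʳ n)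

∑-snoc : ∀ n f → ∑< (suc n) f ≡ ∑< n f + f n
∑-snoc zero    f = +-comm (f 0) 0
∑-snoc (suc n) f = trans (cong (f 0 +_) (∑-snoc n (f ∘ suc))) (sym (+-assoc (f 0) _ _))

∑-distrib-+ : ∀ n f g → ∑[ j < n ] (f j + g j) ≡ ∑< n f + ∑< n g
∑-distrib-+ zero    f g = refl
∑-distrib-+ (suc n) f g =
  trans (cong (f 0 + g 0 +_) (∑-distrib-+ n (f ∘ suc) (g ∘ suc))) (interchange (f 0) (g 0) _ _)

∑-distribˡ-* : ∀ n c f → ∑[ j < n ] (c * f j) ≡ c * ∑< n f
∑-distribˡ-* zero    c f = sym (*-zeroʳ c)
∑-distribˡ-* (suc n) c f =
  trans (cong (c * f 0 +_) (∑-distribˡ-* n c (f ∘ suc))) (sym (*-distribˡ-+ c (f 0) _))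

∑-split : ∀ a b f → ∑< (a + b) f ≡ ∑< a f + ∑[ j < b ] f (a + j)
∑-split zero    b f = refl
∑-split (suc a) b f = trans (cong (f 0 +_) (∑-split a b (f ∘ suc))) (sym (+-assoc (f 0) _ _))

∑-/-% : ∀ a s .{{_ : NonZero s}} (f : ℕ → ℕ → ℕ) →
        ∑[ y < a * s ] f (y / s) (y % s) ≡ ∑[ t < a ] ∑[ j < s ] f t j
∑-/-% zero    s f = refl
∑-/-% (suc a) s f = begin
  ∑[ y < s + a * s ] f (y / s) (y % s)
    ≡⟨ ∑-split s (a * s) _ ⟩
  ∑[ j < s ] f (j / s) (j % s) + ∑[ y < a * s ] f ((s + y) / s) ((s + y) % s)
    ≡⟨ cong₂ _+_ (∑-cong s (λ j j<s → cong₂ f (m<n⇒m/n≡0 j<s) (m<n⇒m%n≡m j<s)))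
                 (∑-cong (a * s) (λ y _ → cong₂ f ([s+y]/s y) ([s+y]%s y))) ⟩
  ∑[ j < s ] f 0 j + ∑[ y < a * s ] f (suc (y / s)) (y % s)
    ≡⟨ cong (∑[ j < s ] f 0 j +_) (∑-/-% a s (f ∘ suc)) ⟩
  ∑[ j < s ] f 0 j + ∑[ t < a ] ∑[ j < s ] f (suc t) j ∎
  where
  open ≡-Reasoning
  [s+y]/s : ∀ y → (s + y) / s ≡ suc (y / s)
  [s+y]/s y = trans (+-distrib-/-∣ˡ y (∣-refl {s})) (cong (_+ y / s) (n/n≡1 s))
  [s+y]%s : ∀ y → (s + y) % s ≡ y % s
  [s+y]%s y = trans (cong (_% s) (+-comm s y)) ([m+n]%n≡m%n y s)

sum-allFin : ∀ n (g : ℕ → ℕ) → sum (map (g ∘ toℕ) (allFin n)) ≡ ∑< n g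
sum-allFin n g = trans (cong sum (map-tabulate {n = n} id (g ∘ toℕ))) (sum-tabulate n g)
  where
  sum-tabulate : ∀ n (g : ℕ → ℕ) → sum (tabulate {n = n} (g ∘ toℕ)) ≡ ∑< n g
  sum-tabulate zero    g = refl
  sum-tabulate (suc n) g = cong (g 0 +_) (sum-tabulate n (g ∘ suc))

∑-rotate : ∀ s .{{_ : NonZero s}} h i → ∑[ j < s ] h ((j + i) % s) ≡ ∑< s h
∑-rotate s@(suc s-1) h zero = ∑-cong s (λ j j<s → cong h (trans (cong (_% s) (+-identityʳ j)) (m<n⇒m%n≡m j<s)))
∑-rotate s@(suc s-1) h (suc i) = begin
  ∑[ j < s ] h ((j + suc i) % s)       ≡⟨ ∑-cong s (λ j _ → cong h (shift j)) ⟩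
  ∑[ j < s ] g (suc j % s)             ≡⟨ ∑-snoc s-1 _ ⟩
  ∑[ j < s-1 ] g (suc j % s) + g (s % s)
    ≡⟨ cong₂ _+_ (∑-cong s-1 (λ j j<s-1 → cong g (m<n⇒m%n≡m (s<s j<s-1)))) (cong g (n%n≡0 s)) ⟩
  ∑[ j < s-1 ] g (suc j) + g 0         ≡⟨ +-comm _ (g 0) ⟩
  ∑[ j < s ] g j                       ≡⟨ ∑-rotate s h i ⟩
  ∑< s h ∎
  where
  open ≡-Reasoning
  g : ℕ → ℕ
  g y = h ((y + i) % s)
  shift : ∀ j → (j + suc i) % s ≡ (suc j % s + i) % s
  shift j = sym (begin
    (suc j % s + i) % s            ≡⟨ %-distribˡ-+ (suc j % s) i s ⟩
    (suc j % s % s + i % s) % s    ≡⟨ cong (λ x → (x + i % s) % s) (m%n%n≡m%n (suc j) s) ⟩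
    (suc j % s + i % s) % s        ≡⟨ sym (%-distribˡ-+ (suc j) i s) ⟩
    (suc j + i) % s                ≡⟨ cong (_% s) (sym (+-suc j i)) ⟩
    (j + suc i) % s ∎)

gauss : ∀ n → 2 * ∑[ a < suc n ] a ≡ n * suc n
gauss zero    = refl
gauss (suc n) = begin
  2 * ∑[ a < suc (suc n) ] a        ≡⟨ cong (2 *_) (∑-snoc (suc n) id) ⟩
  2 * (∑[ a < suc n ] a + suc n)    ≡⟨ *-distribˡ-+ 2 (∑[ a < suc n ] a) (suc n) ⟩
  2 * ∑[ a < suc n ] a + 2 * suc n  ≡⟨ cong (_+ 2 * suc n) (gauss n) ⟩
  n * suc n + 2 * suc n             ≡⟨ expand n ⟩
  suc n * suc (suc n) ∎
  where
  open ≡-Reasoning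
  expand : ∀ n → n * suc n + 2 * suc n ≡ suc n * suc (suc n)
  expand = ℕ-Solver.solve-∀

cubic-bound : ∀ k L → 1 ≤ k → k * (suc k * suc k) * (L * L) ≤ 4 * k ^ 3 * L ^ 2
cubic-bound k L 1≤k = begin
  k * (suc k * suc k) * (L * L)      ≤⟨ *-monoˡ-≤ (L * L) (*-monoʳ-≤ k (*-mono-≤ 1+k≤2k 1+k≤2k)) ⟩
  k * ((k + k) * (k + k)) * (L * L)  ≡⟨ expand k L ⟩
  4 * k ^ 3 * L ^ 2 ∎
  where
  open ≤-Reasoning
  1+k≤2k : suc k ≤ k + k
  1+k≤2k = +-monoˡ-≤ k 1≤k
  expand : ∀ k L → k * ((k + k) * (k + k)) * (L * L) ≡ 4 * (k * (k * (k * 1))) * (L * (L * 1))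
  expand = ℕ-Solver.solve-∀

count-< : ∀ {p s} → p ≤ s → ∑[ j < s ] indicator (j <ᵇ p) ≡ p
count-< {s = s} z≤n = ∑-zero s
count-< (s≤s p≤s) = cong suc (count-< p≤s)

count-≮ : ∀ {p s} → p ≤ s → ∑[ j < s ] indicator (not (j <ᵇ p)) ≡ s ∸ p
count-≮ {s = s} z≤n = trans (∑-const s 1) (*-identityʳ s)
count-≮ (s≤s p≤s) = count-≮ p≤s

count-rotated-< : ∀ s .{{_ : NonZero s}} {p} i → p ≤ s → ∑[ j < s ] indicator ((j + i) % s <ᵇ p) ≡ p
count-rotated-< s {p} i p≤s = trans (∑-rotate s (λ y → indicator (y <ᵇ p)) i) (count-< p≤s)

count-rotated-≮ : ∀ s .{{_ : NonZero s}} {p} i → p ≤ s → ∑[ j < s ] indicator (not ((j + i) % s <ᵇ p)) ≡ s ∸ p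
count-rotated-≮ s {p} i p≤s = trans (∑-rotate s (λ y → indicator (not (y <ᵇ p))) i) (count-≮ p≤s)

<⇒<ᵇ≡true : ∀ {m n} → m < n → (m <ᵇ n) ≡ true
<⇒<ᵇ≡true m<n = Equivalence.to T-≡ (<⇒<ᵇ m<n)

≡ᵇ-refl : ∀ a → (a ≡ᵇ a) ≡ true
≡ᵇ-refl zero    = refl
≡ᵇ-refl (suc a) = ≡ᵇ-refl a

≡ᵇ-sym : ∀ a b → (a ≡ᵇ b) ≡ (b ≡ᵇ a)
≡ᵇ-sym zero    zero    = refl
≡ᵇ-sym zero    (suc b) = refl
≡ᵇ-sym (suc a) zero    = refl
≡ᵇ-sym (suc a) (suc b) = ≡ᵇ-sym a b

≡ᵇ≡true⇒≡ : ∀ a b → (a ≡ᵇ b) ≡ true → a ≡ b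
≡ᵇ≡true⇒≡ a b eq = ≡ᵇ⇒≡ a b (Equivalence.from T-≡ eq)

1+n≢ᵇn : ∀ a → (suc a ≡ᵇ a) ≡ false
1+n≢ᵇn zero    = refl
1+n≢ᵇn (suc a) = 1+n≢ᵇn a

2+n≢ᵇn : ∀ a → (suc (suc a) ≡ᵇ a) ≡ false
2+n≢ᵇn zero    = refl
2+n≢ᵇn (suc a) = 2+n≢ᵇn a

∑-select : ∀ n c (f : ℕ → ℕ) → ∑[ a < n ] (if c ≡ᵇ a then f a else 0) ≡ (if c <ᵇ n then f c else 0)
∑-select zero    c       f = refl
∑-select (suc n) zero    f = trans (cong (f 0 +_) (∑-zero n)) (+-identityʳ (f 0))
∑-select (suc n) (suc c) f = ∑-select n c (f ∘ suc)

module _ {n} (G : OrientedGraph n) (h : Fin n → ℕ) (arc-climbs≤1 : ∀ u v → T (arc G u v) → h v ≤ suc (h u)) where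

  path-climbs≤length : ∀ {l} (p : DirectedPath G l) → h (end p) ≤ h (start p) + l
  path-climbs≤length {l} p = climb l (Fin.fromℕ l) (FinP.toℕ-fromℕ l)
    where
    climb : ∀ k (x : Fin (suc l)) → toℕ x ≡ k → h (vertex p x) ≤ h (start p) + k
    climb zero    Fin.zero    _   = m≤m+n _ 0
    climb (suc k) (Fin.suc j) x≡k = begin
      h (vertex p (Fin.suc j))             ≤⟨ arc-climbs≤1 _ _ (edges p j) ⟩
      suc (h (vertex p (Fin.inject₁ j)))   ≤⟨ s≤s (climb k (Fin.inject₁ j) (trans (FinP.toℕ-inject₁ j) (suc-injective x≡k))) ⟩
      suc (h (start p) + k)                ≡⟨ sym (+-suc _ k) ⟩
      h (start p) + suc k ∎
      where open ≤-Reasoning hiding (start)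

  pathLocalOptimum-byHeight : ∀ L → (∀ u v → h v ≤ h u + L → disc G v ℤ.≤ disc G u ℤ.+ ℤ.+ 2) →
                              PathLocalOptimum L G
  pathLocalOptimum-byHeight L disc-slow l l≤L p =
    ℤP.≤⇒≯ (disc-slow (start p) (end p) (≤-trans (path-climbs≤length p) (+-monoʳ-≤ _ l≤L)))

module _ where
  open import Data.Integer using (+_; _-_; ∣_∣)

  i≤+∣i∣ : ∀ i → i ℤ.≤ + ∣ i ∣
  i≤+∣i∣ (+ _)      = ℤP.≤-refl
  i≤+∣i∣ ℤ.-[1+ _ ] = ℤ.-≤+

  +[m∸n]≡+m-+n : ∀ {m n} → n ≤ m → + (m ∸ n) ≡ + m - + n
  +[m∸n]≡+m-+n {m} {n} n≤m = sym (trans (ℤP.m-n≡m⊖n m n) (ℤP.⊖-≥ n≤m))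

  ∣q-m∣≤m : ∀ {q m} → q ≤ 2 * m → ∣ + q - + m ∣ ≤ m
  ∣q-m∣≤m {q} {m} q≤2m rewrite ℤP.m-n≡m⊖n q m with ≤-total m q
  ... | inj₁ m≤q rewrite ℤP.⊖-≥ m≤q = m≤n+o⇒m∸n≤o q m (≤-trans q≤2m (≤-reflexive (cong (_+_ m) (+-identityʳ m))))
  ... | inj₂ q≤m rewrite ℤP.∣⊖∣-≤ q≤m = m∸n≤m m q

-- Vertex t * s + i is position i on layer t.  The arc between (t , x) and (t + 1 , y) points
-- up iff (x + y) mod s < P t; this circulant pattern gives every vertex of layer t exactly
-- P t arcs up and every vertex of layer t + 1 exactly P t arcs from below.
module Layered (layers s : ℕ) .{{_ : NonZero s}} (P : ℕ → ℕ) (P≤s : ∀ c → P c ≤ s) where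

  open import Data.Integer using (ℤ; +_; _-_)
  open import Data.Integer.Tactic.RingSolver using (solve-∀)

  forward : ℕ → ℕ → ℕ → Bool
  forward c x y = (x + y) % s <ᵇ P c

  forward-comm : ∀ c x y → forward c x y ≡ forward c y x
  forward-comm c x y = cong (λ z → z % s <ᵇ P c) (+-comm x y)

  arcℕ : ℕ → ℕ → ℕ → ℕ → Bool
  arcℕ a x b y =
    if suc a ≡ᵇ b then forward a x y
    else if suc b ≡ᵇ a then not (forward b y x)
    else false

  arcℕ-irreflexive : ∀ a x → arcℕ a x a x ≡ false
  arcℕ-irreflexive a x rewrite 1+n≢ᵇn a = refl

  arcℕ-asymmetric : ∀ a x b y → T (arcℕ a x b y) → arcℕ b y a x ≡ false
  arcℕ-asymmetric a x b y h with suc a ≡ᵇ b in a+1≡b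
  ... | true with refl ← ≡ᵇ≡true⇒≡ (suc a) b a+1≡b
    rewrite 2+n≢ᵇn a | ≡ᵇ-refl a | Equivalence.to T-≡ h = refl
  ... | false with suc b ≡ᵇ a in b+1≡a
  ...   | true with refl ← ≡ᵇ≡true⇒≡ (suc b) a b+1≡a
    rewrite ≡ᵇ-refl b = Equivalence.to T-not-≡ h

  arcℕ-climbs≤1 : ∀ a x b y → T (arcℕ a x b y) → b ≤ suc a
  arcℕ-climbs≤1 a x b y h with suc a ≡ᵇ b in a+1≡b
  ... | true with refl ← ≡ᵇ≡true⇒≡ (suc a) b a+1≡b = ≤-refl
  ... | false with suc b ≡ᵇ a in b+1≡a
  ...   | true with refl ← ≡ᵇ≡true⇒≡ (suc b) a b+1≡a = ≤-trans (n≤1+n b) (n≤1+n (suc b))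

  n : ℕ
  n = layers * s

  layer position : Fin n → ℕ
  layer u = toℕ u / s
  position u = toℕ u % s

  layer<layers : ∀ v → layer v < layers
  layer<layers v = m<n*o⇒m/o<n (FinP.toℕ<n v)

  G : OrientedGraph n
  G = record
    { arc      = λ u v → arcℕ (layer u) (position u) (layer v) (position v)
    ; loopless = λ v → arcℕ-irreflexive (layer v) (position v)
    ; oriented = λ u v → arcℕ-asymmetric (layer u) (position u) (layer v) (position v)
    }

  in-arcs-from : ∀ a t i →
    ∑[ x < s ] indicator (arcℕ a x t i) ≡ (if suc a ≡ᵇ t then P a else 0) + (if suc t ≡ᵇ a then s ∸ P t else 0)
  in-arcs-from a t i with suc a ≡ᵇ t in a+1≡t
  ... | true with refl ← ≡ᵇ≡true⇒≡ (suc a) t a+1≡t rewrite 2+n≢ᵇn a =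
    trans (count-rotated-< s i (P≤s a)) (sym (+-identityʳ (P a)))
  ... | false with suc t ≡ᵇ a
  ...   | true  = trans (∑-cong s (λ x _ → cong (indicator ∘ not) (forward-comm t i x)))
                        (count-rotated-≮ s i (P≤s t))
  ...   | false = ∑-zero s

  out-arcs-to : ∀ a t i →
    ∑[ y < s ] indicator (arcℕ t i a y) ≡ (if suc t ≡ᵇ a then P t else 0) + (if suc a ≡ᵇ t then s ∸ P a else 0)
  out-arcs-to a t i with suc t ≡ᵇ a in t+1≡a
  ... | true with refl ← ≡ᵇ≡true⇒≡ (suc t) a t+1≡a rewrite 2+n≢ᵇn t =
    trans (∑-cong s (λ y _ → cong indicator (forward-comm t i y)))
          (trans (count-rotated-< s i (P≤s t)) (sym (+-identityʳ (P t))))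
  ... | false with suc a ≡ᵇ t
  ...   | true  = count-rotated-≮ s i (P≤s a)
  ...   | false = ∑-zero s

  below : (ℕ → ℕ) → ℕ → ℕ
  below f zero    = 0
  below f (suc c) = f c

  above : ℕ → ℕ → ℕ
  above t y = if suc t <ᵇ layers then y else 0

  ∑-below : ∀ f t → t < layers → ∑[ a < layers ] (if suc a ≡ᵇ t then f a else 0) ≡ below f t
  ∑-below f zero    _        = ∑-zero layers
  ∑-below f (suc c) c+1<layers = begin
    ∑[ a < layers ] (if a ≡ᵇ c then f a else 0)
      ≡⟨ ∑-cong layers (λ a _ → cong (λ b → if b then f a else 0) (≡ᵇ-sym a c)) ⟩
    ∑[ a < layers ] (if c ≡ᵇ a then f a else 0)
      ≡⟨ ∑-select layers c f ⟩
    (if c <ᵇ layers then f c else 0)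
      ≡⟨ cong (λ b → if b then f c else 0) (<⇒<ᵇ≡true (<-trans (n<1+n c) c+1<layers)) ⟩
    f c ∎
    where open ≡-Reasoning

  indeg-layered : ∀ v → indeg G v ≡ below P (layer v) + above (layer v) (s ∸ P (layer v))
  indeg-layered v = begin
    indeg G v
      ≡⟨ sum-allFin n (λ y → indicator (arcℕ (y / s) (y % s) t i)) ⟩
    ∑[ y < layers * s ] indicator (arcℕ (y / s) (y % s) t i)
      ≡⟨ ∑-/-% layers s (λ a x → indicator (arcℕ a x t i)) ⟩
    ∑[ a < layers ] ∑[ x < s ] indicator (arcℕ a x t i)
      ≡⟨ ∑-cong layers (λ a _ → in-arcs-from a t i) ⟩
    ∑[ a < layers ] ((if suc a ≡ᵇ t then P a else 0) + (if suc t ≡ᵇ a then s ∸ P t else 0))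
      ≡⟨ ∑-distrib-+ layers _ _ ⟩
    ∑[ a < layers ] (if suc a ≡ᵇ t then P a else 0) + ∑[ a < layers ] (if suc t ≡ᵇ a then s ∸ P t else 0)
      ≡⟨ cong₂ _+_ (∑-below P t (layer<layers v)) (∑-select layers (suc t) (λ _ → s ∸ P t)) ⟩
    below P t + above t (s ∸ P t) ∎
    where
    open ≡-Reasoning
    t i : ℕ
    t = layer v
    i = position v

  outdeg-layered : ∀ v → outdeg G v ≡ below (λ c → s ∸ P c) (layer v) + above (layer v) (P (layer v))
  outdeg-layered v = begin
    outdeg G v
      ≡⟨ sum-allFin n (λ y → indicator (arcℕ t i (y / s) (y % s))) ⟩
    ∑[ y < layers * s ] indicator (arcℕ t i (y / s) (y % s))
      ≡⟨ ∑-/-% layers s (λ a y → indicator (arcℕ t i a y)) ⟩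
    ∑[ a < layers ] ∑[ y < s ] indicator (arcℕ t i a y)
      ≡⟨ ∑-cong layers (λ a _ → out-arcs-to a t i) ⟩
    ∑[ a < layers ] ((if suc t ≡ᵇ a then P t else 0) + (if suc a ≡ᵇ t then s ∸ P a else 0))
      ≡⟨ ∑-distrib-+ layers _ _ ⟩
    ∑[ a < layers ] (if suc t ≡ᵇ a then P t else 0) + ∑[ a < layers ] (if suc a ≡ᵇ t then s ∸ P a else 0)
      ≡⟨ +-comm (∑[ a < layers ] (if suc t ≡ᵇ a then P t else 0)) _ ⟩
    ∑[ a < layers ] (if suc a ≡ᵇ t then s ∸ P a else 0) + ∑[ a < layers ] (if suc t ≡ᵇ a then P t else 0)
      ≡⟨ cong₂ _+_ (∑-below (λ c → s ∸ P c) t (layer<layers v)) (∑-select layers (suc t) (λ _ → P t)) ⟩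
    below (λ c → s ∸ P c) t + above t (P t) ∎
    where
    open ≡-Reasoning
    t i : ℕ
    t = layer v
    i = position v

  -- cut c: arcs entering a vertex of layer c − 1 from layer c, minus those leaving it there.
  cut : ℕ → ℤ
  cut zero    = + 0
  cut (suc c) = if suc c <ᵇ layers then + (s ∸ P c) - + P c else + 0

  disc-layered : ∀ v → disc G v ≡ cut (suc (layer v)) - cut (layer v)
  disc-layered v = begin
    + indeg G v - + outdeg G v
      ≡⟨ cong₂ (λ i o → + i - + o) (indeg-layered v) (outdeg-layered v) ⟩
    + (below P t + above t (s ∸ P t)) - + (below (λ c → s ∸ P c) t + above t (P t))
      ≡⟨ regroup (below P t) (above t (s ∸ P t)) (below (λ c → s ∸ P c) t) (above t (P t)) ⟩
    (+ above t (s ∸ P t) - + above t (P t)) - (+ below (λ c → s ∸ P c) t - + below P t)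
      ≡⟨ cong₂ _-_ (above-cut t) (below-cut t (layer<layers v)) ⟩
    cut (suc t) - cut t ∎
    where
    open ≡-Reasoning
    t : ℕ
    t = layer v
    regroup : ∀ a b c d → + (a + b) - + (c + d) ≡ (+ b - + d) - (+ c - + a)
    regroup a b c d = trans (cong₂ _-_ (ℤP.pos-+ a b) (ℤP.pos-+ c d)) (ring (+ a) (+ b) (+ c) (+ d))
      where
      ring : ∀ a b c d → (a ℤ.+ b) - (c ℤ.+ d) ≡ (b - d) - (c - a)
      ring = solve-∀
    above-cut : ∀ t → + above t (s ∸ P t) - + above t (P t) ≡ cut (suc t)
    above-cut t with suc t <ᵇ layers
    ... | true  = refl
    ... | false = refl
    below-cut : ∀ t → t < layers → + below (λ c → s ∸ P c) t - + below P t ≡ cut t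
    below-cut zero    _            = refl
    below-cut (suc c) c+1<layers rewrite <⇒<ᵇ≡true c+1<layers = refl

module Staircase (m-1 L-1 : ℕ) where

  open import Data.Integer using (ℤ; +_; -_; _-_; ∣_∣)
  open import Data.Integer.Tactic.RingSolver using (solve-∀)

  m L k layers σ s : ℕ
  m      = suc m-1
  L      = suc L-1
  k      = 2 * m
  layers = suc k * L
  σ      = layers * m
  s      = σ + σ

  level : ℕ → ℕ
  level t = t / L

  e : ℕ → ℤ
  e t = + level t - + m

  D : ℕ → ℤ
  D t = + ∑[ j < t ] level j - + (t * m)

  -- With P t = σ − D (t + 1), cut t = 2 D t, so layer t has discrepancy 2 e t; D vanishes at
  -- both ends as the staircase is symmetric about 0.  On actual layers 0 ≤ σ − D (t + 1) ≤ s,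
  -- so the truncation at s only serves to make P ≤ s hold everywhere.
  P : ℕ → ℕ
  P t = ∣ + σ - D (suc t) ∣ ⊓ s

  P≤s : ∀ c → P c ≤ s
  P≤s c = m⊓n≤n _ s

  open Layered layers s P P≤s public

  level≤k : ∀ t → t < layers → level t ≤ k
  level≤k t t<layers = ≤-pred (m<n*o⇒m/o<n t<layers)

  ∣e∣≤m : ∀ t → t < layers → ∣ e t ∣ ≤ m
  ∣e∣≤m t t<layers = ∣q-m∣≤m (level≤k t t<layers)

  D-suc : ∀ t → D (suc t) ≡ D t ℤ.+ e t
  D-suc t = begin
    + ∑[ j < suc t ] level j - + (m + t * m)
      ≡⟨ cong (λ x → + x - + (m + t * m)) (∑-snoc t level) ⟩
    + (∑< t level + level t) - + (m + t * m)
      ≡⟨ cong₂ _-_ (ℤP.pos-+ (∑< t level) (level t)) (ℤP.pos-+ m (t * m)) ⟩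
    (+ ∑< t level ℤ.+ + level t) - (+ m ℤ.+ + (t * m))
      ≡⟨ regroup (+ ∑< t level) (+ level t) (+ m) (+ (t * m)) ⟩
    D t ℤ.+ e t ∎
    where
    open ≡-Reasoning
    regroup : ∀ a b c d → (a ℤ.+ b) - (c ℤ.+ d) ≡ (a - d) ℤ.+ (b - c)
    regroup = solve-∀

  ∣D∣≤ : ∀ t → t ≤ layers → ∣ D t ∣ ≤ t * m
  ∣D∣≤ zero    _            = z≤n
  ∣D∣≤ (suc t) t<layers = begin
    ∣ D (suc t) ∣          ≡⟨ cong ∣_∣ (D-suc t) ⟩
    ∣ D t ℤ.+ e t ∣        ≤⟨ ℤP.∣i+j∣≤∣i∣+∣j∣ (D t) (e t) ⟩
    ∣ D t ∣ + ∣ e t ∣      ≤⟨ +-mono-≤ (∣D∣≤ t (<⇒≤ t<layers)) (∣e∣≤m t t<layers) ⟩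
    t * m + m              ≡⟨ +-comm (t * m) m ⟩
    suc t * m ∎
    where open ≤-Reasoning

  ∑-level : ∑[ j < layers ] level j ≡ layers * m
  ∑-level = begin
    ∑[ j < suc k * L ] (j / L)     ≡⟨ ∑-/-% (suc k) L (λ q _ → q) ⟩
    ∑[ q < suc k ] ∑[ r < L ] q    ≡⟨ ∑-cong (suc k) (λ q _ → ∑-const L q) ⟩
    ∑[ q < suc k ] (L * q)         ≡⟨ ∑-distribˡ-* (suc k) L id ⟩
    L * ∑[ q < suc k ] q           ≡⟨ cong (L *_) ∑q≡m[1+k] ⟩
    L * (m * suc k)                ≡⟨ rearrange L m (suc k) ⟩
    suc k * L * m ∎
    where
    open ≡-Reasoning
    ∑q≡m[1+k] : ∑[ q < suc k ] q ≡ m * suc k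
    ∑q≡m[1+k] = *-cancelˡ-≡ _ _ 2 (trans (gauss k) (*-assoc 2 m (suc k)))
    rearrange : ∀ a b c → a * (b * c) ≡ c * a * b
    rearrange = ℕ-Solver.solve-∀

  D-layers : D layers ≡ + 0
  D-layers = trans (cong (λ x → + x - + (layers * m)) ∑-level) (ℤP.+-inverseʳ (+ (layers * m)))

  P-exact : ∀ t → t < layers → + P t ≡ + σ - D (suc t)
  P-exact t t<layers = begin
    + (∣ + σ - D (suc t) ∣ ⊓ s)    ≡⟨ cong +_ (m≤n⇒m⊓n≡m ∣σ-D∣≤s) ⟩
    + ∣ + σ - D (suc t) ∣          ≡⟨ ℤP.0≤i⇒+∣i∣≡i (ℤP.i≤j⇒0≤j-i D≤σ) ⟩
    + σ - D (suc t) ∎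
    where
    open ≡-Reasoning
    ∣D∣≤σ : ∣ D (suc t) ∣ ≤ σ
    ∣D∣≤σ = ≤-trans (∣D∣≤ (suc t) t<layers) (*-monoˡ-≤ m t<layers)
    D≤σ : D (suc t) ℤ.≤ + σ
    D≤σ = ℤP.≤-trans (i≤+∣i∣ (D (suc t))) (ℤ.+≤+ ∣D∣≤σ)
    ∣σ-D∣≤s : ∣ + σ - D (suc t) ∣ ≤ s
    ∣σ-D∣≤s = ≤-trans (ℤP.∣i-j∣≤∣i∣+∣j∣ (+ σ) (D (suc t))) (+-monoʳ-≤ σ ∣D∣≤σ)

  cut≡2D : ∀ t → t ≤ layers → cut t ≡ + 2 ℤ.* D t
  cut≡2D zero    _ = refl
  cut≡2D (suc c) c+1≤layers with suc c <ᵇ layers in c+1<ᵇlayers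
  ... | true = begin
    + (s ∸ P c) - + P c                          ≡⟨ cong (_- + P c) (+[m∸n]≡+m-+n (P≤s c)) ⟩
    (+ s - + P c) - + P c                        ≡⟨ cong₂ (λ x y → (x - y) - y) (ℤP.pos-+ σ σ) (P-exact c c<layers) ⟩
    ((+ σ ℤ.+ + σ) - (+ σ - D (suc c))) - (+ σ - D (suc c))  ≡⟨ cancel (+ σ) (D (suc c)) ⟩
    + 2 ℤ.* D (suc c) ∎
    where
    open ≡-Reasoning
    c<layers : c < layers
    c<layers = <-trans (n<1+n c) (<ᵇ⇒< (suc c) layers (Equivalence.from T-≡ c+1<ᵇlayers))
    cancel : ∀ a d → ((a ℤ.+ a) - (a - d)) - (a - d) ≡ + 2 ℤ.* d
    cancel = solve-∀
  ... | false = sym (cong (+ 2 ℤ.*_) (trans (cong D c+1≡layers) D-layers))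
    where
    c+1≡layers : suc c ≡ layers
    c+1≡layers = ≤-antisym c+1≤layers (≮⇒≥ (λ c+1<layers → subst T c+1<ᵇlayers (<⇒<ᵇ c+1<layers)))

  disc≡2e : ∀ v → disc G v ≡ + 2 ℤ.* e (layer v)
  disc≡2e v = begin
    disc G v                            ≡⟨ disc-layered v ⟩
    cut (suc t) - cut t                 ≡⟨ cong₂ _-_ (cut≡2D (suc t) (layer<layers v)) (cut≡2D t (<⇒≤ (layer<layers v))) ⟩
    + 2 ℤ.* D (suc t) - + 2 ℤ.* D t     ≡⟨ cong (λ x → + 2 ℤ.* x - + 2 ℤ.* D t) (D-suc t) ⟩
    + 2 ℤ.* (D t ℤ.+ e t) - + 2 ℤ.* D t ≡⟨ cancel (D t) (e t) ⟩
    + 2 ℤ.* e t ∎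
    where
    open ≡-Reasoning
    t : ℕ
    t = layer v
    cancel : ∀ d x → + 2 ℤ.* (d ℤ.+ x) - + 2 ℤ.* d ≡ + 2 ℤ.* x
    cancel = solve-∀

  e-slow : ∀ a b → b ≤ a + L → e b ℤ.≤ e a ℤ.+ + 1
  e-slow a b b≤a+L = begin
    + level b - + m              ≤⟨ ℤP.+-monoˡ-≤ (- + m) (ℤ.+≤+ level-b≤) ⟩
    + (level a + 1) - + m        ≡⟨ cong (_- + m) (ℤP.pos-+ (level a) 1) ⟩
    (+ level a ℤ.+ + 1) - + m    ≡⟨ swap (+ level a) (+ m) ⟩
    e a ℤ.+ + 1 ∎
    where
    open ℤP.≤-Reasoning
    level-b≤ : level b ≤ level a + 1
    level-b≤ = ≤-trans (/-monoˡ-≤ L b≤a+L)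
      (≤-reflexive (trans (+-distrib-/-∣ʳ a (∣-refl {L})) (cong (_+_ (level a)) (n/n≡1 L))))
    swap : ∀ x y → (x ℤ.+ + 1) - y ≡ (x - y) ℤ.+ + 1
    swap = solve-∀

  disc-slow : ∀ u v → layer v ≤ layer u + L → disc G v ℤ.≤ disc G u ℤ.+ + 2
  disc-slow u v lv≤lu+L = begin
    disc G v                        ≡⟨ disc≡2e v ⟩
    + 2 ℤ.* e (layer v)             ≤⟨ ℤP.*-monoˡ-≤-nonNeg (+ 2) (e-slow (layer u) (layer v) lv≤lu+L) ⟩
    + 2 ℤ.* (e (layer u) ℤ.+ + 1)   ≡⟨ ℤP.*-distribˡ-+ (+ 2) (e (layer u)) (+ 1) ⟩
    + 2 ℤ.* e (layer u) ℤ.+ + 2     ≡⟨ cong (ℤ._+ + 2) (sym (disc≡2e u)) ⟩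
    disc G u ℤ.+ + 2 ∎
    where open ℤP.≤-Reasoning

  optimum : PathLocalOptimum L G
  optimum = pathLocalOptimum-byHeight G layer
    (λ u v → arcℕ-climbs≤1 (layer u) (position u) (layer v) (position v)) L disc-slow

  discrepancy : HasDiscrepancy G k
  discrepancy = ∣disc∣≤k , Fin.zero , trans (cong ∣_∣ (disc≡2e Fin.zero)) (ℤP.abs-* (+ 2) (e 0))
    where
    ∣disc∣≤k : ∀ v → ∣ disc G v ∣ ≤ k
    ∣disc∣≤k v = begin
      ∣ disc G v ∣                 ≡⟨ cong ∣_∣ (disc≡2e v) ⟩
      ∣ + 2 ℤ.* e (layer v) ∣      ≡⟨ ℤP.abs-* (+ 2) (e (layer v)) ⟩
      2 * ∣ e (layer v) ∣          ≤⟨ *-monoʳ-≤ 2 (∣e∣≤m (layer v) (layer<layers v)) ⟩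
      k ∎
      where open ≤-Reasoning

  size : n ≤ 4 * k ^ 3 * L ^ 2
  size = ≤-trans (≤-reflexive (expand m L)) (cubic-bound k L (s≤s z≤n))
    where
    expand : ∀ m L → suc (2 * m) * L * (suc (2 * m) * L * m + suc (2 * m) * L * m)
                   ≡ 2 * m * (suc (2 * m) * suc (2 * m)) * (L * L)
    expand = ℕ-Solver.solve-∀

lemma5p3 : ∃ λ (C : ℕ) → ∀ (L : ℕ) → 1 ≤ L → ∀ (N : ℕ) →
    ∃ λ (k : ℕ) → N ≤ k × ∃ λ (n : ℕ) → Σ (OrientedGraph n) λ G →
      PathLocalOptimum L G × HasDiscrepancy G k × n ≤ C * (k ^ 3) * (L ^ 2)
lemma5p3 = 4 , λ where
  (suc L-1) _ N → let open Staircase N L-1 in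
    k , ≤-trans (n≤1+n N) (m≤m+n m _) , n , G , optimum , discrepancy , size
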